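{- Let $r\in(\mathbb{N}\setminus\{1\})\cup\{\infty\}$. A finite simple graph $G$ has radius-$r$ flip-width at most $2$ if and only if $G$ contains no induced subgraph isomorphic to $C_5$, the bull, the gem, or the co-gem.
   Context: $\mathbb{N}$ is the set of positive integers. All graphs are finite, undirected, simple. Flips: for a graph $G$ and $A,B\subseteq V(G)$, $G\oplus(A,B)$ is the graph on $V(G)$ in which, for distinct $u,v$, $uv$ is an edge iff either $(u,v)\in(A\times B)\cup(B\times A)$ and $uv\notin E(G)$, or $(u,v)\notin(A\times B)\cup(B\times A)$ and $uv\in E(G)$. For a collection $\mathcal{S}$ of such pairs, $G\oplus\mathcal{S}$ is obtained by flipping all pairs in $\mathcal{S}$ successively (order is irrelevant). For a partition $\mathcal{P}$ of $V(G)$, a $\mathcal{P}$-flip of $G$ is any graph $G\oplus\mathcal{S}$ where every pair in $\mathcal{S}$ is $(X,Y)$ with $X,Y\in\mathcal{P}$ (possibly $X=Y$); it is a $k$-flip if $|\mathcal{P}|\le k$. Flipper game of radius $r\in\mathbb{N}\cup\{\infty\}$ and width $k$ on $G$: set $G_0=G$; the runner picks a starting vertex $v_0$. In round $i\ge1$ the flipper announces a $k$-flip $G_i$ of $G$; knowing $G_i$, the runner picks $v_i\in V(G)$ reachable from $v_{i-1}$ by a path of length at most $r$ in $G_{i-1}$ (for $r=\infty$: any vertex in the same component of $G_{i-1}$). The flipper wins as soon as the runner's position $v_i$ is an isolated vertex of $G_i$. The radius-$r$ flip-width $\mathrm{fw}_r(G)$ is the minimum $k$ such that the flipper has a winning strategy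 (winning after finitely many rounds) in this game. $C_5$ is the 5-cycle; with $abcd$ an induced path on four vertices and a fifth vertex $v$: the bull has $v$ adjacent exactly to $b,c$; the gem has $v$ adjacent to $a,b,c,d$; the co-gem has $v$ adjacent to none of them. -}

module Defs where

open import Data.Nat using (ℕ; zero; suc; _≤_)
open import Data.Fin using (Fin; zero; suc; _≟_)
open import Data.Bool using (Bool; true; false; _∧_; _∨_; _xor_; not)
open import Data.List using (List; []; _∷_; foldr; map)
open import Data.Bool.ListAction using (any)
open import Data.Product using (Σ; _×_; _,_; ∃; ∃-syntax)
open import Data.Sum using (_⊎_)
open import Relation.Nullary using (¬_)
open import Relation.Nullary.Decidable using (⌊_⌋)
open import Relation.Binary.PropositionalEquality using (_≡_)
open import Function.Definitions using (Injective)

Adj : ℕ → Set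
Adj n = Fin n → Fin n → Bool

record SimpleGraph (n : ℕ) : Set where
  field
    adj    : Adj n
    sym    : ∀ u v → adj u v ≡ adj v u
    irrefl : ∀ u → adj u u ≡ false
open SimpleGraph public

VSet : ℕ → Set
VSet n = Fin n → Bool

flip : ∀ {n} → Adj n → VSet n × VSet n → Adj n
flip E (A , B) u v =
  not ⌊ u ≟ v ⌋ ∧ (E u v xor ((A u ∧ B v) ∨ (B u ∧ A v)))

flipAll : ∀ {n} → Adj n → List (VSet n × VSet n) → Adj n
flipAll E S = foldr (λ p H → flip H p) E S

-- A partition of V(G) into at most k parts, given by a colouring c : Fin n → Fin k;
-- the parts are the (non-empty) colour classes.
part : ∀ {n k} → (Fin n → Fin k) → Fin k → VSet n
part c i u = ⌊ c u ≟ i ⌋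

partFlip : ∀ {n k} → Adj n → (Fin n → Fin k) → List (Fin k × Fin k) → Adj n
partFlip E c S = flipAll E (map (λ { (i , j) → part c i , part c j }) S)

-- Walks of length at most m from u to w in H (a path of length ≤ m exists iff
-- a walk of length ≤ m exists).
data Walk {n : ℕ} (H : Adj n) : ℕ → Fin n → Fin n → Set where
  here : ∀ {m u} → Walk H m u u
  step : ∀ {m u v w} → H u v ≡ true → Walk H m v w → Walk H (suc m) u w

data Radius : Set where
  fin : ℕ → Radius
  ∞   : Radius

Reach : ∀ {n} → Radius → Adj n → Fin n → Fin n → Set
Reach (fin r) H v w = Walk H r v w
Reach ∞       H v w = ∃[ m ] Walk H m v w

Isolated : ∀ {n} → Adj n → Fin n → Set
Isolated H v = ∀ w → H v w ≡ false

-- FlipperWins r k G H v : in the flipper game of radius r and width k on G,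
-- when the previous graph is H (= G_{i-1}) and the runner is at v (= v_{i-1}),
-- the flipper can force a win within finitely many further rounds.
data FlipperWins {n : ℕ} (r : Radius) (k : ℕ) (G : SimpleGraph n)
     : Adj n → Fin n → Set where
  move : ∀ {H v} (c : Fin n → Fin k) (S : List (Fin k × Fin k)) →
         (∀ w → Reach r H v w →
            Isolated (partFlip (adj G) c S) w
            ⊎ FlipperWins r k G (partFlip (adj G) c S) w) →
         FlipperWins r k G H v

FlipperWinsGame : ∀ {n} → Radius → ℕ → SimpleGraph n → Set
FlipperWinsGame r k G = ∀ v₀ → FlipperWins r k G (adj G) v₀

FlipWidthAtMost : ∀ {n} → Radius → ℕ → SimpleGraph n → Set
FlipWidthAtMost r k G = ∃[ k' ] (k' ≤ k × FlipperWinsGame r k' G)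

-- r ∈ (ℕ ∖ {1}) ∪ {∞}, with ℕ the positive integers.
ValidRadius : Radius → Set
ValidRadius (fin r) = 2 ≤ r
ValidRadius ∞       = Data.Unit.⊤
  where import Data.Unit

fromEdges : List (Fin 5 × Fin 5) → Adj 5
fromEdges es i j =
  any (λ { (a , b) → (⌊ a ≟ i ⌋ ∧ ⌊ b ≟ j ⌋) ∨ (⌊ a ≟ j ⌋ ∧ ⌊ b ≟ i ⌋) }) es

-- Vertices: a = 0, b = 1, c = 2, d = 3 (induced path abcd), v = 4.
v0 v1 v2 v3 v4 : Fin 5
v0 = zero
v1 = suc zero
v2 = suc (suc zero)
v3 = suc (suc (suc zero))
v4 = suc (suc (suc (suc zero)))
C5 bull gem cogem : Adj 5
C5    = fromEdges ((v0 , v1) ∷ (v1 , v2) ∷ (v2 , v3) ∷ (v3 , v4) ∷ (v4 , v0) ∷ [])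
bull  = fromEdges ((v0 , v1) ∷ (v1 , v2) ∷ (v2 , v3) ∷ (v4 , v1) ∷ (v4 , v2) ∷ [])
gem   = fromEdges ((v0 , v1) ∷ (v1 , v2) ∷ (v2 , v3)
                   ∷ (v4 , v0) ∷ (v4 , v1) ∷ (v4 , v2) ∷ (v4 , v3) ∷ [])
cogem = fromEdges ((v0 , v1) ∷ (v1 , v2) ∷ (v2 , v3) ∷ [])

HasInduced : ∀ {n m} → SimpleGraph n → Adj m → Set
HasInduced {n} {m} G H =
  Σ (Fin m → Fin n) λ f → Injective _≡_ _≡_ f × (∀ i j → adj G (f i) (f j) ≡ H i j)

-- A graph containing C5, the bull, the gem or the co-gem defeats the flipper: the runner stays on
-- that copy F, since every 2-flip of G restricts to a 2-flip of F, and a finite check shows that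
-- from a non-isolated vertex of one 2-flip of F some vertex at distance at most 2 is non-isolated
-- in any other. Conversely these four graphs are exactly the Seidel switchings of the co-gem fixing
-- its isolated vertex. So if G avoids them and the flipper first isolates the runner's vertex v by
-- switching along N(v), the switched graph J has no induced P4, i.e. it is a cograph. The flipper
-- then keeps the runner inside a set K whose outside vertices all see K like v or oppositely, and
-- uses a cut of J on K (disconnected or co-disconnected) to shrink K with one 2-flip per round.

module Submission where

open import Defs hiding (sym)
open import Data.Nat using (ℕ; _≤_; _<_; z≤n; s≤s)
open import Data.Nat.Induction using (<-wellFounded)
open import Data.Nat.Properties using (≤-refl)
open import Data.Bool using (Bool; true; false; not; _∧_; _∨_; _xor_; if_then_else_)
import Data.Bool as Bool
open import Data.Bool.Properties
  using ( ∧-comm; ∨-comm; ∧-conicalˡ; ∧-conicalʳ; ∧-zeroʳ; xor-assoc; xor-comm; xor-identityʳ; xor-same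
        ; not-involutive; ¬-not)
open import Data.Empty using (⊥-elim)
open import Data.Fin using (Fin; zero; suc; _≟_; #_)
open import Data.Fin.Properties using (any?; all?)
open import Data.Fin.Subset using (Subset; ∣_∣)
import Data.Fin.Subset as Subset
open import Data.Fin.Subset.Properties using (anySubset?; p⊂q⇒∣p∣<∣q∣)
open import Data.List using (List; []; _∷_)
open import Data.Product using (Σ; ∃; ∃₂; _×_; _,_; proj₁; proj₂)
open import Data.Sum using (_⊎_; inj₁; inj₂)
import Data.Sum as Sum
open import Data.Vec using (Vec; []; _∷_; lookup; tabulate; replicate)
open import Data.Vec.Properties using (lookup∘tabulate; lookup⇒[]=; []=⇒lookup; lookup-replicate)
open import Function.Base using (_∘_; case_of_)
open import Function.Bundles using (_⇔_; mk⇔)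
open import Function.Definitions using (Injective)
open import Induction.WellFounded using (WellFounded; Acc; acc)
open import Level using (0ℓ)
import Relation.Binary.Construct.On as On
open import Relation.Binary.PropositionalEquality
  using (_≡_; _≢_; refl; sym; trans; cong; cong₂; module ≡-Reasoning)
open import Relation.Nullary using (¬_; Dec; yes; no; ¬?; _×-dec_; _⊎-dec_; _→-dec_; contradiction)
open import Relation.Nullary.Decidable
  using (⌊_⌋; True; map′; toWitness; decidable-stable; dec-true; dec-false; isYes≗does)
open import Relation.Unary using (Pred; Decidable)

open ≡-Reasoning

private variable
  n m k : ℕ

witness : ∀ {A : Set} {d : Dec A} → ⌊ d ⌋ ≡ true → A
witness {d = yes a} _ = a

refutation : ∀ {A : Set} {d : Dec A} → ⌊ d ⌋ ≡ false → ¬ A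
refutation {d = no ¬a} _ = ¬a

⌊⌋-yes : ∀ {A : Set} (d : Dec A) → A → ⌊ d ⌋ ≡ true
⌊⌋-yes d a = trans (isYes≗does d) (dec-true d a)

⌊⌋-no : ∀ {A : Set} (d : Dec A) → ¬ A → ⌊ d ⌋ ≡ false
⌊⌋-no d ¬a = trans (isYes≗does d) (dec-false d ¬a)

-- Case analysis through ≡-or-≢ and ∈-or-∉, unlike `with` on the underlying Boolean test,
-- leaves the occurrences of that test in the context untouched.
≡-or-≢ : ∀ (x y : Fin n) → x ≡ y ⊎ x ≢ y
≡-or-≢ x y with x ≟ y
... | yes x≡y = inj₁ x≡y
... | no x≢y  = inj₂ x≢y

not-swap : ∀ {x y} → not x ≡ y → x ≡ not y
not-swap {x} refl = sym (not-involutive x)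

xor-cancelʳ : ∀ x y → (x xor y) xor y ≡ x
xor-cancelʳ x y = begin
  (x xor y) xor y   ≡⟨ xor-assoc x y y ⟩
  x xor (y xor y)   ≡⟨ cong (x xor_) (xor-same y) ⟩
  x xor false       ≡⟨ xor-identityʳ x ⟩
  x                 ∎

xor-cancel-both : ∀ p q e → (p xor e) xor (q xor e) ≡ p xor q
xor-cancel-both false false false = refl
xor-cancel-both false false true  = refl
xor-cancel-both false true  false = refl
xor-cancel-both false true  true  = refl
xor-cancel-both true  false false = refl
xor-cancel-both true  false true  = refl
xor-cancel-both true  true  false = refl
xor-cancel-both true  true  true  = refl

xor-cancel-outer : ∀ t p e → (t xor p) xor ((p xor e) xor t) ≡ e
xor-cancel-outer false false e = xor-identityʳ e
xor-cancel-outer false true  false = refl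
xor-cancel-outer false true  true  = refl
xor-cancel-outer true  false false = refl
xor-cancel-outer true  false true  = refl
xor-cancel-outer true  true  false = refl
xor-cancel-outer true  true  true  = refl

infix  4 _∈_ _∉_ _⊆_ _≺_
infixr 6 _∩_
infixl 6 _─_

_∈_ _∉_ : Fin n → VSet n → Set
x ∈ K = K x ≡ true
x ∉ K = K x ≡ false

_⊆_ : VSet n → VSet n → Set
K' ⊆ K = ∀ {x} → x ∈ K' → x ∈ K

∈-∉-absurd : ∀ {K : VSet n} {x} → x ∈ K → ¬ x ∉ K
∈-∉-absurd x∈K x∉K = case trans (sym x∈K) x∉K of λ ()

∈-or-∉ : ∀ (K : VSet n) x → x ∈ K ⊎ x ∉ K
∈-or-∉ K x with K x
... | true  = inj₁ refl
... | false = inj₂ refl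

_∩_ : VSet n → VSet n → VSet n
(K ∩ L) x = K x ∧ L x

∩-⁻ : ∀ (K L : VSet n) {x} → x ∈ K ∩ L → x ∈ K × x ∈ L
∩-⁻ K L {x} p = ∧-conicalˡ (K x) (L x) p , ∧-conicalʳ (K x) (L x) p

∩-⁺ : ∀ (K L : VSet n) {x} → x ∈ K → x ∈ L → x ∈ K ∩ L
∩-⁺ _ _ x∈K x∈L rewrite x∈K | x∈L = refl

∉-∩ : ∀ (K L : VSet n) {x} → x ∈ K → x ∉ K ∩ L → x ∉ L
∉-∩ _ _ x∈K x∉K∩L rewrite x∈K = x∉K∩L

∉-∩ˡ : ∀ (K L : VSet n) {x} → x ∉ K → x ∉ K ∩ L
∉-∩ˡ _ _ x∉K rewrite x∉K = refl

∉-∩ʳ : ∀ (K L : VSet n) {x} → x ∈ K → x ∉ L → x ∉ K ∩ L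
∉-∩ʳ _ _ x∈K x∉L rewrite x∈K = x∉L

allBut : Fin n → VSet n
allBut v x = not ⌊ x ≟ v ⌋

allBut-∈ : ∀ {v x : Fin n} → x ≢ v → x ∈ allBut v
allBut-∈ {v = v} {x} x≢v = cong not (⌊⌋-no (x ≟ v) x≢v)

allBut-excludes : ∀ (v : Fin n) → v ∉ allBut v
allBut-excludes v = cong not (⌊⌋-yes (v ≟ v) refl)

allBut-≢ : ∀ {v x : Fin n} → x ∈ allBut v → x ≢ v
allBut-≢ {v = v} x∈ refl = ∈-∉-absurd {K = allBut v} x∈ (allBut-excludes v)

allBut-∉ : ∀ {v x : Fin n} → x ∉ allBut v → x ≡ v
allBut-∉ x∉ = witness (not-swap x∉)

only : Fin n → VSet n
only v x = ⌊ x ≟ v ⌋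

only-∈ : ∀ {v x : Fin n} → x ∈ only v → x ≡ v
only-∈ = witness

only-∉ : ∀ {v x : Fin n} → x ∉ only v → x ≢ v
only-∉ = refutation

only-self : ∀ (v : Fin n) → v ∈ only v
only-self v = ⌊⌋-yes (v ≟ v) refl

_─_ : VSet n → Fin n → VSet n
K ─ v = K ∩ allBut v

─-⊆ : ∀ (K : VSet n) v → K ─ v ⊆ K
─-⊆ K v = proj₁ ∘ ∩-⁻ K (allBut v)

─-∈ : ∀ (K : VSet n) {v x} → x ∈ K → x ≢ v → x ∈ K ─ v
─-∈ K {v} x∈K x≢v = ∩-⁺ K (allBut v) x∈K (allBut-∈ x≢v)

─-≢ : ∀ (K : VSet n) {v x} → x ∈ K ─ v → x ≢ v
─-≢ K {v} = allBut-≢ ∘ proj₂ ∘ ∩-⁻ K (allBut v)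

─-excludes : ∀ (K : VSet n) v → v ∉ K ─ v
─-excludes K v = trans (cong (K v ∧_) (allBut-excludes v)) (∧-zeroʳ (K v))

∈-∉-≢ : ∀ {K : VSet n} {a b} → a ∈ K → b ∉ K → K a ≢ K b
∈-∉-≢ {K = K} a∈K b∉K Ka≡Kb = ∈-∉-absurd {K = K} a∈K (trans Ka≡Kb b∉K)

size : VSet n → ℕ
size K = ∣ tabulate K ∣

_≺_ : VSet n → VSet n → Set
K' ≺ K = size K' < size K

≺-wellFounded : WellFounded (_≺_ {n})
≺-wellFounded = On.wellFounded size <-wellFounded

≺-⊂ : ∀ {K' K : VSet n} {x} → K' ⊆ K → x ∈ K → x ∉ K' → K' ≺ K
≺-⊂ {K' = K'} {K} {x} K'⊆K x∈K x∉K' =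
  p⊂q⇒∣p∣<∣q∣ ( (λ y∈ → to (K'⊆K (from {L = K'} y∈)))
              , x , to x∈K , λ x∈K' → ∈-∉-absurd {K = K'} (from x∈K') x∉K')
  where
  to : ∀ {L : VSet n} {y} → y ∈ L → y Subset.∈ tabulate L
  to {L = L} {y} y∈L = lookup⇒[]= y (tabulate L) (trans (lookup∘tabulate L y) y∈L)
  from : ∀ {L : VSet n} {y} → y Subset.∈ tabulate L → y ∈ L
  from {L = L} {y} y∈ = trans (sym (lookup∘tabulate L y)) ([]=⇒lookup y∈)

Closed : Adj n → VSet n → Set
Closed H K = ∀ {a b} → a ∈ K → H a b ≡ true → b ∈ K

walk-closed : ∀ {H : Adj n} {K u w} → Closed H K → Walk H m u w → u ∈ K → w ∈ K
walk-closed closed here u∈K = u∈K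
walk-closed closed (step uv walk) u∈K = walk-closed closed walk (closed u∈K uv)

reach-closed : ∀ r {H : Adj n} {K u w} → Closed H K → Reach r H u w → u ∈ K → w ∈ K
reach-closed (fin _) closed walk = walk-closed closed walk
reach-closed ∞ closed (_ , walk) = walk-closed closed walk

Symmetric : Adj n → Set
Symmetric H = ∀ a b → H a b ≡ H b a

Irreflexive : Adj n → Set
Irreflexive H = ∀ a → H a a ≡ false

crosses : Fin k × Fin k → Fin k → Fin k → Bool
crosses (i , j) a b = (⌊ a ≟ i ⌋ ∧ ⌊ b ≟ j ⌋) ∨ (⌊ a ≟ j ⌋ ∧ ⌊ b ≟ i ⌋)

flipPattern : List (Fin k × Fin k) → Fin k → Fin k → Bool
flipPattern []      a b = false
flipPattern (p ∷ S) a b = flipPattern S a b xor crosses p a b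

flipPattern-sym : ∀ (S : List (Fin k × Fin k)) a b → flipPattern S a b ≡ flipPattern S b a
flipPattern-sym []            a b = refl
flipPattern-sym ((i , j) ∷ S) a b =
  cong₂ _xor_ (flipPattern-sym S a b)
    (trans (∨-comm (⌊ a ≟ i ⌋ ∧ ⌊ b ≟ j ⌋) _)
           (cong₂ _∨_ (∧-comm ⌊ a ≟ j ⌋ ⌊ b ≟ i ⌋) (∧-comm ⌊ a ≟ i ⌋ ⌊ b ≟ j ⌋)))

partFlip-pattern : ∀ {E : Adj n} → Irreflexive E → ∀ (c : Fin n → Fin k) S u v →
  partFlip E c S u v ≡ not ⌊ u ≟ v ⌋ ∧ (E u v xor flipPattern S (c u) (c v))
partFlip-pattern irr c [] u v with u ≟ v
... | yes refl = irr u
... | no _     = sym (xor-identityʳ _)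
partFlip-pattern {E = E} irr c ((i , j) ∷ S) u v = begin
  not d ∧ (partFlip E c S u v xor t)       ≡⟨ cong (λ z → not d ∧ (z xor t)) (partFlip-pattern irr c S u v) ⟩
  not d ∧ ((not d ∧ (E u v xor φ)) xor t)  ≡⟨ absorb d ⟩
  not d ∧ ((E u v xor φ) xor t)            ≡⟨ cong (not d ∧_) (xor-assoc (E u v) φ t) ⟩
  not d ∧ (E u v xor (φ xor t))            ∎
  where
  d = ⌊ u ≟ v ⌋
  t = crosses (i , j) (c u) (c v)
  φ = flipPattern S (c u) (c v)
  absorb : ∀ d {x} → not d ∧ ((not d ∧ x) xor t) ≡ not d ∧ (x xor t)
  absorb true  = refl
  absorb false = refl

Embeds : Adj n → Adj m → Set
Embeds {n} {m} H F = Σ (Fin m → Fin n) λ f → Injective _≡_ _≡_ f × (∀ i j → H (f i) (f j) ≡ F i j)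

embeds-trans : ∀ {l} {H : Adj n} {T : Adj m} {F : Adj l} → Embeds H T → Embeds T F → Embeds H F
embeds-trans (f , f-inj , f-emb) (g , g-inj , g-emb) =
  f ∘ g , g-inj ∘ f-inj , λ i j → trans (f-emb (g i) (g j)) (g-emb i j)

IsEmbedding : Adj n → Adj m → (Fin m → Fin n) → Set
IsEmbedding H F f = (∀ i j → f i ≡ f j → i ≡ j) × (∀ i j → H (f i) (f j) ≡ F i j)

isEmbedding? : (H : Adj n) (F : Adj m) (f : Fin m → Fin n) → Dec (IsEmbedding H F f)
isEmbedding? H F f =
  all? (λ i → all? λ j → (f i ≟ f j) →-dec (i ≟ j))
  ×-dec all? (λ i → all? λ j → H (f i) (f j) Bool.≟ F i j)

NoFalseTwins : Adj m → Set
NoFalseTwins F = ∀ i j → i ≢ j → F i j ≡ true ⊎ ∃ λ l → F i l ≢ F j l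

noFalseTwins? : (F : Adj m) → Dec (NoFalseTwins F)
noFalseTwins? F = all? λ i → all? λ j → ¬? (i ≟ j) →-dec
  ((F i j Bool.≟ true) ⊎-dec any? λ l → ¬? (F i l Bool.≟ F j l))

realisation-injective : ∀ {H : Adj n} {F : Adj m} {g : Fin m → Fin n} →
  Irreflexive H → NoFalseTwins F → (∀ i j → H (g i) (g j) ≡ F i j) → Injective _≡_ _≡_ g
realisation-injective {H = H} {F} {g} irr twins real {i} {j} gi≡gj with i ≟ j
... | yes i≡j = i≡j
... | no i≢j with twins i j i≢j
...   | inj₁ Fij = case loop of λ ()
  where
  loop : true ≡ false
  loop = begin
    true              ≡⟨ sym Fij ⟩
    F i j             ≡⟨ sym (real i j) ⟩
    H (g i) (g j)     ≡⟨ cong (H (g i)) (sym gi≡gj) ⟩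
    H (g i) (g i)     ≡⟨ irr (g i) ⟩
    false             ∎
...   | inj₂ (l , Fil≢Fjl) = contradiction same Fil≢Fjl
  where
  same : F i l ≡ F j l
  same = begin
    F i l             ≡⟨ sym (real i l) ⟩
    H (g i) (g l)     ≡⟨ cong (λ z → H z (g l)) gi≡gj ⟩
    H (g j) (g l)     ≡⟨ real j l ⟩
    F j l             ∎

Forbidden : Adj n → Set
Forbidden H = Embeds H C5 ⊎ Embeds H bull ⊎ Embeds H gem ⊎ Embeds H cogem

forbidden-embeds : ∀ {H : Adj n} {T : Adj m} → Embeds H T → Forbidden T → Forbidden H
forbidden-embeds {H = H} {T} e = Sum.map along (Sum.map along (Sum.map along along))
  where
  along : ∀ {F : Adj 5} → Embeds T F → Embeds H F
  along = embeds-trans {H = H} {T = T} e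

-- Seidel switching

switch : VSet n → Adj n → Adj n
switch β E x y = E x y xor (β x xor β y)

switch-involutive : ∀ β (E : Adj n) x y → switch β (switch β E) x y ≡ E x y
switch-involutive β E x y = xor-cancelʳ (E x y) (β x xor β y)

-- In via π, the i-th entry of π is the vertex of T playing the role of vertex i of F.
data Isomorphic (T : Adj 5) : Adj 5 → Set where
  via : ∀ {F} (π : Vec (Fin 5) 5) {_ : True (isEmbedding? T F (lookup π))} → Isomorphic T F

isomorphic-embeds : ∀ {T F : Adj 5} → Isomorphic T F → Embeds T F
isomorphic-embeds (via π {ok}) = let inj , emb = toWitness ok in lookup π , (λ {i} {j} → inj i j) , emb

switchedCogem : Bool → Bool → Bool → Bool → Adj 5
switchedCogem p₀ p₁ p₂ p₃ = switch (lookup (p₀ ∷ p₁ ∷ p₂ ∷ p₃ ∷ false ∷ [])) cogem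

cogem-switching-class : ∀ p₀ p₁ p₂ p₃ →
  let T = switchedCogem p₀ p₁ p₂ p₃ in
  Isomorphic T C5 ⊎ Isomorphic T bull ⊎ Isomorphic T gem ⊎ Isomorphic T cogem
cogem-switching-class false false false false = inj₂ (inj₂ (inj₂ (via (# 0 ∷ # 1 ∷ # 2 ∷ # 3 ∷ # 4 ∷ []))))
cogem-switching-class false false false true  = inj₂ (inj₁ (via (# 2 ∷ # 1 ∷ # 3 ∷ # 4 ∷ # 0 ∷ [])))
cogem-switching-class false false true  false = inj₂ (inj₂ (inj₂ (via (# 1 ∷ # 0 ∷ # 2 ∷ # 4 ∷ # 3 ∷ []))))
cogem-switching-class false false true  true  = inj₂ (inj₂ (inj₁ (via (# 1 ∷ # 0 ∷ # 2 ∷ # 4 ∷ # 3 ∷ []))))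
cogem-switching-class false true  false false = inj₂ (inj₂ (inj₂ (via (# 2 ∷ # 3 ∷ # 1 ∷ # 4 ∷ # 0 ∷ []))))
cogem-switching-class false true  false true  = inj₂ (inj₂ (inj₂ (via (# 0 ∷ # 3 ∷ # 4 ∷ # 1 ∷ # 2 ∷ []))))
cogem-switching-class false true  true  false = inj₂ (inj₁ (via (# 0 ∷ # 2 ∷ # 1 ∷ # 3 ∷ # 4 ∷ [])))
cogem-switching-class false true  true  true  = inj₂ (inj₂ (inj₁ (via (# 0 ∷ # 3 ∷ # 4 ∷ # 1 ∷ # 2 ∷ []))))
cogem-switching-class true  false false false = inj₂ (inj₁ (via (# 1 ∷ # 2 ∷ # 0 ∷ # 4 ∷ # 3 ∷ [])))
cogem-switching-class true  false false true  = inj₁ (via (# 0 ∷ # 2 ∷ # 1 ∷ # 3 ∷ # 4 ∷ []))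
cogem-switching-class true  false true  false = inj₂ (inj₂ (inj₂ (via (# 2 ∷ # 4 ∷ # 0 ∷ # 3 ∷ # 1 ∷ []))))
cogem-switching-class true  false true  true  = inj₂ (inj₁ (via (# 0 ∷ # 4 ∷ # 3 ∷ # 1 ∷ # 2 ∷ [])))
cogem-switching-class true  true  false false = inj₂ (inj₂ (inj₁ (via (# 2 ∷ # 3 ∷ # 1 ∷ # 4 ∷ # 0 ∷ []))))
cogem-switching-class true  true  false true  = inj₂ (inj₁ (via (# 2 ∷ # 0 ∷ # 4 ∷ # 3 ∷ # 1 ∷ [])))
cogem-switching-class true  true  true  false = inj₂ (inj₂ (inj₁ (via (# 2 ∷ # 4 ∷ # 0 ∷ # 3 ∷ # 1 ∷ []))))
cogem-switching-class true  true  true  true  = inj₂ (inj₂ (inj₁ (via (# 0 ∷ # 1 ∷ # 2 ∷ # 3 ∷ # 4 ∷ []))))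

switchedCogem-forbidden : ∀ p₀ p₁ p₂ p₃ → Forbidden (switchedCogem p₀ p₁ p₂ p₃)
switchedCogem-forbidden p₀ p₁ p₂ p₃ =
  Sum.map isomorphic-embeds (Sum.map isomorphic-embeds (Sum.map isomorphic-embeds isomorphic-embeds))
    (cogem-switching-class p₀ p₁ p₂ p₃)

cogem-noFalseTwins : NoFalseTwins cogem
cogem-noFalseTwins = toWitness {a? = noFalseTwins? cogem} _

-- Cographs

record InducedP4 (H : Adj n) (K : VSet n) : Set where
  constructor p4
  field
    a b c d : Fin n
    a∈K : a ∈ K
    b∈K : b ∈ K
    c∈K : c ∈ K
    d∈K : d ∈ K
    ab : H a b ≡ true
    bc : H b c ≡ true
    cd : H c d ≡ true
    ac : H a c ≡ false
    bd : H b d ≡ false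
    ad : H a d ≡ false

record UniformCut (H : Adj n) (K : VSet n) (e : Bool) : Set where
  constructor cut
  field
    side : VSet n
    inner outer : Fin n
    inner∈K : inner ∈ K
    outer∈K : outer ∈ K
    inner-side : inner ∈ side
    outer-side : outer ∉ side
    across : ∀ {a b} → a ∈ K → b ∈ K → side a ≢ side b → H a b ≡ e

AtMostOne : VSet n → Set
AtMostOne K = ∀ {a b} → a ∈ K → b ∈ K → a ≡ b

complement : Adj n → Adj n
complement H a b = not (H a b)

mkCut : ∀ {H : Adj n} {K e} → Symmetric H → (side : VSet n) {a b : Fin n} →
  a ∈ K → b ∈ K → a ∈ side → b ∉ side →
  (∀ {x y} → x ∈ K → y ∈ K → x ∈ side → y ∉ side → H x y ≡ e) → UniformCut H K e
mkCut {H = H} {K} {e} H-sym side a∈K b∈K a-in b-out one-way = cut side _ _ a∈K b∈K a-in b-out both-ways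
  where
  both-ways : ∀ {x y} → x ∈ K → y ∈ K → side x ≢ side y → H x y ≡ e
  both-ways {x} {y} x∈K y∈K differ with side x in sx | side y in sy
  ... | true  | true  = contradiction refl differ
  ... | false | false = contradiction refl differ
  ... | true  | false = one-way x∈K y∈K sx sy
  ... | false | true  = trans (H-sym x y) (one-way y∈K x∈K sy sx)

cut-swap : ∀ {H : Adj n} {K e} → UniformCut H K e → UniformCut H K e
cut-swap (cut side inner outer inner∈K outer∈K inner-side outer-side across) =
  cut (not ∘ side) outer inner outer∈K inner∈K (cong not outer-side) (cong not inner-side)
      (λ a∈K b∈K differ → across a∈K b∈K (differ ∘ cong not))

cut-negate : ∀ {H H' : Adj n} {K e} → (∀ a b → H' a b ≡ not (H a b)) →
  UniformCut H K e → UniformCut H' K (not e)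
cut-negate neg (cut side inner outer inner∈K outer∈K inner-side outer-side across) =
  cut side inner outer inner∈K outer∈K inner-side outer-side
      (λ {a} {b} a∈K b∈K differ → trans (neg a b) (cong not (across a∈K b∈K differ)))

-- The complement of the path abcd is the path bdac.
p4-complement : ∀ {H : Adj n} {K} → Symmetric H → InducedP4 (complement H) K → InducedP4 H K
p4-complement H-sym (p4 a b c d a∈K b∈K c∈K d∈K ab bc cd ac bd ad) =
  p4 b d a c b∈K d∈K a∈K c∈K
     (not-swap bd) (trans (H-sym d a) (not-swap ad)) (not-swap ac)
     (trans (H-sym b a) (not-swap ab)) (trans (H-sym d c) (not-swap cd)) (not-swap bc)

p4-weaken : ∀ {H : Adj n} {K' K} → K' ⊆ K → InducedP4 H K' → InducedP4 H K
p4-weaken sub (p4 a b c d a∈K b∈K c∈K d∈K ab bc cd ac bd ad) =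
  p4 a b c d (sub a∈K) (sub b∈K) (sub c∈K) (sub d∈K) ab bc cd ac bd ad

module _ {H : Adj n} (H-sym : Symmetric H) {K : VSet n} {v : Fin n} (v∈K : v ∈ K) where

  private
    K' = K ─ v

  module _ (c : UniformCut H K' false) where
    open UniformCut c

    Bridge : Fin n → Fin n → Set
    Bridge x y = x ∈ K' × x ∈ side × H v x ≡ true × y ∈ K' × y ∈ side × H v y ≡ false × H x y ≡ true

    bridge? : ∀ x y → Dec (Bridge x y)
    bridge? x y = (K' x Bool.≟ true) ×-dec (side x Bool.≟ true) ×-dec (H v x Bool.≟ true)
            ×-dec (K' y Bool.≟ true) ×-dec (side y Bool.≟ true) ×-dec (H v y Bool.≟ false) ×-dec (H x y Bool.≟ true)

    OuterNeighbour : Fin n → Set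
    OuterNeighbour p = p ∈ K' × p ∉ side × H v p ≡ true

    outerNeighbour? : ∀ p → Dec (OuterNeighbour p)
    outerNeighbour? p = (K' p Bool.≟ true) ×-dec (side p Bool.≟ false) ×-dec (H v p Bool.≟ true)

    non-neighbours-cut : ¬ (∃₂ Bridge) → ∀ {u} → u ∈ K' → u ∈ side → H v u ≡ false →
      UniformCut H K false
    non-neighbours-cut no-bridge {u} u∈K' u-in v≁u =
      mkCut H-sym T (─-⊆ K v u∈K') v∈K (T-⁺ u∈K' u-in v≁u) (∉-∩ˡ K' (side ∩ nonNeighbours) (─-excludes K v)) edges
      where
      nonNeighbours = not ∘ H v
      T = K' ∩ side ∩ nonNeighbours

      T-⁺ : ∀ {x} → x ∈ K' → x ∈ side → H v x ≡ false → x ∈ T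
      T-⁺ x∈K' x-in v≁x = ∩-⁺ K' (side ∩ nonNeighbours) x∈K' (∩-⁺ side nonNeighbours x-in (cong not v≁x))

      T-⁻ : ∀ {x} → x ∈ T → x ∈ K' × x ∈ side × H v x ≡ false
      T-⁻ x∈T with ∩-⁻ K' (side ∩ nonNeighbours) x∈T
      ... | x∈K' , x∈side∩ with ∩-⁻ side nonNeighbours x∈side∩
      ...   | x-in , v≁x = x∈K' , x-in , not-swap v≁x

      edges : ∀ {x y} → x ∈ K → y ∈ K → x ∈ T → y ∉ T → H x y ≡ false
      edges {x} {y} x∈K y∈K x∈T y∉T with ≡-or-≢ y v | T-⁻ x∈T
      ... | inj₁ refl | _ , _ , v≁x = trans (H-sym x v) v≁x
      ... | inj₂ y≢v  | x∈K' , x-in , v≁x with ∈-or-∉ side y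
      ...   | inj₂ y-side = across x∈K' (─-∈ K y∈K y≢v) (∈-∉-≢ {K = side} x-in y-side)
      ...   | inj₁ y-side = trans (H-sym x y) (¬-not λ y~x → no-bridge (y , x , y∈K' , y-side , v~y , x∈K' , x-in , v≁x , y~x))
        where
        y∈K' = ─-∈ K y∈K y≢v
        v~y = ¬-not λ v≁y → ∈-∉-absurd {K = T} (T-⁺ y∈K' y-side v≁y) y∉T

    outer-side-cut : ¬ ∃ OuterNeighbour → UniformCut H K false
    outer-side-cut no-neighbour =
      mkCut H-sym T (─-⊆ K v outer∈K) v∈K (∩-⁺ K' (not ∘ side) outer∈K (cong not outer-side))
            (∉-∩ˡ K' (not ∘ side) (─-excludes K v)) edges
      where
      T = K' ∩ (not ∘ side)
      edges : ∀ {a b} → a ∈ K → b ∈ K → a ∈ T → b ∉ T → H a b ≡ false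
      edges {a} {b} a∈K b∈K a∈T b∉T with ≡-or-≢ b v | ∩-⁻ K' (not ∘ side) a∈T
      ... | inj₁ refl | a∈K' , a-out =
        trans (H-sym a v) (¬-not λ v~a → no-neighbour (a , a∈K' , not-swap a-out , v~a))
      ... | inj₂ b≢v  | a∈K' , a-out =
        across a∈K' b∈K' λ same →
          ∈-∉-absurd {K = side} (not-swap (∉-∩ K' (not ∘ side) b∈K' b∉T)) (trans (sym same) (not-swap a-out))
        where b∈K' = ─-∈ K b∈K b≢v

    bridge-P4 : ∀ {x y p} → Bridge x y → OuterNeighbour p → InducedP4 H K
    bridge-P4 {x} {y} {p} (x∈K' , x-in , v~x , y∈K' , y-in , v≁y , x~y) (p∈K' , p-out , v~p) =
      p4 y x v p (─-⊆ K v y∈K') (─-⊆ K v x∈K') v∈K (─-⊆ K v p∈K')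
         (trans (H-sym y x) x~y) (trans (H-sym x v) v~x) v~p (trans (H-sym y v) v≁y)
         (across x∈K' p∈K' (∈-∉-≢ {K = side} x-in p-out)) (across y∈K' p∈K' (∈-∉-≢ {K = side} y-in p-out))

    extend-from-non-neighbour : ∀ {u} → u ∈ K' → u ∈ side → H v u ≡ false →
      InducedP4 H K ⊎ ∃ (UniformCut H K)
    extend-from-non-neighbour u∈K' u-in v≁u with any? (λ x → any? (bridge? x)) | any? outerNeighbour?
    ... | no no-bridge         | _                  = inj₂ (false , non-neighbours-cut no-bridge u∈K' u-in v≁u)
    ... | yes (_ , _ , bridge) | yes (_ , neighbour) = inj₁ (bridge-P4 bridge neighbour)
    ... | yes _                | no no-neighbour    = inj₂ (false , outer-side-cut no-neighbour)

  extend-disconnected : UniformCut H K' false → InducedP4 H K ⊎ ∃ (UniformCut H K)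
  extend-disconnected c with any? (λ u → (K' u Bool.≟ true) ×-dec (H v u Bool.≟ false))
  ... | yes (u , u∈K' , v≁u) with UniformCut.side c u in u-side
  ...   | true  = extend-from-non-neighbour c u∈K' u-side v≁u
  ...   | false = extend-from-non-neighbour (cut-swap c) u∈K' (cong not u-side) v≁u
  extend-disconnected c | no all-adjacent =
    inj₂ (true , mkCut H-sym (only v) v∈K (─-⊆ K v inner∈K) (only-self v)
                       (⌊⌋-no (inner ≟ v) (─-≢ K inner∈K)) edges)
    where
    open UniformCut c
    edges : ∀ {x y} → x ∈ K → y ∈ K → x ∈ only v → y ∉ only v → H x y ≡ true
    edges x∈K y∈K x-in y-out with only-∈ x-in
    ... | refl = ¬-not λ v≁y → all-adjacent (_ , ─-∈ K y∈K (only-∉ y-out) , v≁y)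

cograph-decomposition : ∀ {H : Adj n} → Symmetric H → ∀ K → AtMostOne K ⊎ InducedP4 H K ⊎ ∃ (UniformCut H K)
cograph-decomposition {H = H} H-sym K = go K (≺-wellFounded K)
  where
  H̅-sym : Symmetric (complement H)
  H̅-sym a b = cong not (H-sym a b)

  go : ∀ K → Acc _≺_ K → AtMostOne K ⊎ InducedP4 H K ⊎ ∃ (UniformCut H K)
  go K (acc smaller) with any? (λ v → K v Bool.≟ true)
  ... | no empty = inj₁ λ {a} a∈K _ → contradiction (a , a∈K) empty
  ... | yes (v , v∈K) with go (K ─ v) (smaller (≺-⊂ {K' = K ─ v} {K} {v} (─-⊆ K v) v∈K (─-excludes K v)))
  ...   | inj₂ (inj₁ path)         = inj₂ (inj₁ (p4-weaken (─-⊆ K v) path))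
  ...   | inj₂ (inj₂ (false , c)) = inj₂ (extend-disconnected H-sym v∈K c)
  ...   | inj₂ (inj₂ (true , c))  =
    inj₂ (Sum.map (p4-complement H-sym) (λ (e , c̅) → not e , cut-negate (λ _ _ → sym (not-involutive _)) c̅)
                  (extend-disconnected H̅-sym v∈K (cut-negate (λ _ _ → refl) c)))
  ...   | inj₁ at-most-one with any? (λ u → (K ─ v) u Bool.≟ true)
  ...     | no none = inj₁ λ a∈K b∈K → trans (is-v a∈K) (sym (is-v b∈K))
    where
    is-v : ∀ {a} → a ∈ K → a ≡ v
    is-v {a} a∈K with ≡-or-≢ a v
    ... | inj₁ a≡v = a≡v
    ... | inj₂ a≢v = contradiction (a , ─-∈ K a∈K a≢v) none
  ...     | yes (u , u∈K') =
    inj₂ (inj₂ (H v u , mkCut H-sym (only v) v∈K (─-⊆ K v u∈K') (only-self v)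
                              (⌊⌋-no (u ≟ v) (─-≢ K u∈K')) edges))
    where
    edges : ∀ {x y} → x ∈ K → y ∈ K → x ∈ only v → y ∉ only v → H x y ≡ H v u
    edges x∈K y∈K x-in y-out with only-∈ x-in
    ... | refl = cong (H v) (at-most-one (─-∈ K y∈K (only-∉ y-out)) u∈K')

-- The flipper's strategy

toFin2 : Bool → Fin 2
toFin2 false = # 0
toFin2 true  = # 1

switching : Bool → List (Fin 2 × Fin 2)
switching false = (# 0 , # 1) ∷ []
switching true  = (# 0 , # 0) ∷ (# 1 , # 1) ∷ []

flipPattern-switching : ∀ e x y → flipPattern (switching e) (toFin2 x) (toFin2 y) ≡ (x xor y) xor e
flipPattern-switching false false false = refl
flipPattern-switching false false true  = refl
flipPattern-switching false true  false = refl
flipPattern-switching false true  true  = refl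
flipPattern-switching true  false false = refl
flipPattern-switching true  false true  = refl
flipPattern-switching true  true  false = refl
flipPattern-switching true  true  true  = refl

switchingFlip : Adj n → VSet n → Bool → Adj n
switchingFlip E β e = partFlip E (toFin2 ∘ β) (switching e)

module _ {E : Adj n} (E-irr : Irreflexive E) (β : VSet n) (e : Bool) where

  switchingFlip-≡ : ∀ u w → switchingFlip E β e u w ≡ not ⌊ u ≟ w ⌋ ∧ (switch β E u w xor e)
  switchingFlip-≡ u w = begin
    switchingFlip E β e u w
      ≡⟨ partFlip-pattern E-irr (toFin2 ∘ β) (switching e) u w ⟩
    not d ∧ (E u w xor flipPattern (switching e) (toFin2 (β u)) (toFin2 (β w)))
      ≡⟨ cong (λ z → not d ∧ (E u w xor z)) (flipPattern-switching e (β u) (β w)) ⟩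
    not d ∧ (E u w xor ((β u xor β w) xor e))
      ≡⟨ cong (not d ∧_) (sym (xor-assoc (E u w) _ e)) ⟩
    not d ∧ (switch β E u w xor e)
      ∎
    where d = ⌊ u ≟ w ⌋

  switchingFlip-nonedge : ∀ {u w} → switch β E u w ≡ e → switchingFlip E β e u w ≡ false
  switchingFlip-nonedge {u} {w} uw≡e = begin
    switchingFlip E β e u w                ≡⟨ switchingFlip-≡ u w ⟩
    not ⌊ u ≟ w ⌋ ∧ (switch β E u w xor e) ≡⟨ cong (λ z → not ⌊ u ≟ w ⌋ ∧ (z xor e)) uw≡e ⟩
    not ⌊ u ≟ w ⌋ ∧ (e xor e)              ≡⟨ cong (not ⌊ u ≟ w ⌋ ∧_) (xor-same e) ⟩
    not ⌊ u ≟ w ⌋ ∧ false                  ≡⟨ ∧-zeroʳ _ ⟩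
    false                                  ∎

  switchingFlip-loop : ∀ u → switchingFlip E β e u u ≡ false
  switchingFlip-loop u =
    trans (switchingFlip-≡ u u) (cong (λ z → not z ∧ (switch β E u u xor e)) (⌊⌋-yes (u ≟ u) refl))

sameSideAs : VSet n → Fin n → VSet n
sameSideAs s z y = ⌊ s y Bool.≟ s z ⌋

sameSideAs-self : ∀ (s : VSet n) z → z ∈ sameSideAs s z
sameSideAs-self s z = ⌊⌋-yes (s z Bool.≟ s z) refl

cut-opposite : ∀ {H : Adj n} {K e} (c : UniformCut H K e) z →
  ∃ λ y → y ∈ K × UniformCut.side c y ≢ UniformCut.side c z
cut-opposite (cut side inner outer inner∈K outer∈K inner-side outer-side _) z with side z
... | true  = outer , outer∈K , λ same → case trans (sym outer-side) same of λ ()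
... | false = inner , inner∈K , λ same → case trans (sym inner-side) same of λ ()

cut-part-≺ : ∀ {H : Adj n} {K e} (c : UniformCut H K e) z → K ∩ sameSideAs (UniformCut.side c) z ≺ K
cut-part-≺ {K = K} c z with cut-opposite c z
... | y , y∈K , y-opposite =
  ≺-⊂ {K' = K ∩ S} {K} (proj₁ ∘ ∩-⁻ K S) y∈K
      (∉-∩ʳ K S y∈K (⌊⌋-no (side y Bool.≟ side z) y-opposite))
  where
  open UniformCut c
  S = sameSideAs side z

private
  pattern A = zero
  pattern B = suc zero
  pattern C = suc (suc zero)
  pattern D = suc (suc (suc zero))
  pattern V = suc (suc (suc (suc zero)))

module _ {n} (G : SimpleGraph n) (G-free : ¬ Forbidden (adj G)) (r : Radius) where

  private
    E = adj G

    E-sym : Symmetric E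
    E-sym = SimpleGraph.sym G

    E-irr : Irreflexive E
    E-irr = irrefl G

    nonedge : ∀ β e {u w} → switch β E u w ≡ e → switchingFlip E β e u w ≡ false
    nonedge = switchingFlip-nonedge {E = E} E-irr

    loop : ∀ β e u → switchingFlip E β e u u ≡ false
    loop = switchingFlip-loop {E = E} E-irr

  module _ (v : Fin n) where

    J : Adj n
    J = switch (E v) E

    J-sym : Symmetric J
    J-sym x y = cong₂ _xor_ (E-sym x y) (xor-comm (E v x) (E v y))

    J-irr : Irreflexive J
    J-irr x = cong₂ _xor_ (E-irr x) (xor-same (E v x))

    J-row : ∀ x → J v x ≡ false
    J-row x = trans (cong (λ z → E v x xor (z xor E v x)) (E-irr v)) (xor-same (E v x))

    J-col : ∀ x → J x v ≡ false
    J-col x = trans (J-sym x v) (J-row x)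

    flipped : ∀ {x y t} → J x y ≡ t → J y x ≡ t
    flipped {x} {y} = trans (J-sym y x)

    -- An induced P4 of J together with v, which is isolated in J, is an induced co-gem of J;
    -- switching back along N(v) turns it into an induced switching of the co-gem in G.
    induced-P4-forbidden : ∀ {K} → InducedP4 J K → Forbidden E
    induced-P4-forbidden (p4 a b c d _ _ _ _ ab bc cd ac bd ad) =
      forbidden-embeds {H = E} (g , realisation-injective {H = J} J-irr cogem-noFalseTwins g-cogem , g-switched)
        (switchedCogem-forbidden (E v a) (E v b) (E v c) (E v d))
      where
      g : Fin 5 → Fin n
      g = lookup (a ∷ b ∷ c ∷ d ∷ v ∷ [])

      g-cogem : ∀ i j → J (g i) (g j) ≡ cogem i j
      g-cogem A A = J-irr a
      g-cogem A B = ab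
      g-cogem A C = ac
      g-cogem A D = ad
      g-cogem A V = J-col a
      g-cogem B A = flipped ab
      g-cogem B B = J-irr b
      g-cogem B C = bc
      g-cogem B D = bd
      g-cogem B V = J-col b
      g-cogem C A = flipped ac
      g-cogem C B = flipped bc
      g-cogem C C = J-irr c
      g-cogem C D = cd
      g-cogem C V = J-col c
      g-cogem D A = flipped ad
      g-cogem D B = flipped bd
      g-cogem D C = flipped cd
      g-cogem D D = J-irr d
      g-cogem D V = J-col d
      g-cogem V A = J-row a
      g-cogem V B = J-row b
      g-cogem V C = J-row c
      g-cogem V D = J-row d
      g-cogem V V = J-row v

      v-row : ∀ i → E v (g i) ≡ lookup (E v a ∷ E v b ∷ E v c ∷ E v d ∷ false ∷ []) i
      v-row A = refl
      v-row B = refl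
      v-row C = refl
      v-row D = refl
      v-row V = E-irr v

      g-switched : ∀ i j → E (g i) (g j) ≡ switchedCogem (E v a) (E v b) (E v c) (E v d) i j
      g-switched i j = begin
        E (g i) (g j)                               ≡⟨ sym (switch-involutive (E v) E (g i) (g j)) ⟩
        J (g i) (g j) xor (E v (g i) xor E v (g j))
          ≡⟨ cong₂ _xor_ (g-cogem i j) (cong₂ _xor_ (v-row i) (v-row j)) ⟩
        switchedCogem (E v a) (E v b) (E v c) (E v d) i j ∎

    Homogeneous : VSet n → Set
    Homogeneous K = ∀ {b} → b ∉ K → ∃ λ t → ∀ {x} → x ∈ K → E b x ≡ t xor E v x

    -- Outside K the colour records whether a vertex sees K like v or oppositely (read off at w ∈ K);
    -- inside K it is chosen so that on K the flip is J, complemented if e.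
    colouring : Bool → VSet n → Fin n → VSet n
    colouring e K w y = if K y then E v y xor e else E y w xor E v w

    module _ {e : Bool} {K : VSet n} {w : Fin n} where

      colouring-∈ : ∀ {x} → x ∈ K → colouring e K w x ≡ E v x xor e
      colouring-∈ x∈K rewrite x∈K = refl

      colouring-∉ : ∀ {x} → x ∉ K → colouring e K w x ≡ E x w xor E v w
      colouring-∉ x∉K rewrite x∉K = refl

      strategy-inside : ∀ {a b} → a ∈ K → b ∈ K → switch (colouring e K w) E a b ≡ J a b
      strategy-inside {a} {b} a∈K b∈K =
        cong (E a b xor_)
          (trans (cong₂ _xor_ (colouring-∈ a∈K) (colouring-∈ b∈K)) (xor-cancel-both (E v a) (E v b) e))

      strategy-leaves : Homogeneous K → w ∈ K → ∀ {a b} → a ∈ K → b ∉ K →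
        switch (colouring e K w) E a b ≡ e
      strategy-leaves hom w∈K {a} {b} a∈K b∉K with hom b∉K
      ... | t , sees = begin
        E a b xor (colouring e K w a xor colouring e K w b)
          ≡⟨ cong₂ _xor_ (trans (E-sym a b) (sees a∈K))
                         (cong₂ _xor_ (colouring-∈ a∈K) (colouring-∉ b∉K)) ⟩
        (t xor E v a) xor ((E v a xor e) xor (E b w xor E v w))
          ≡⟨ cong (λ z → (t xor E v a) xor ((E v a xor e) xor z))
                  (trans (cong (_xor E v w) (sees w∈K)) (xor-cancelʳ t (E v w))) ⟩
        (t xor E v a) xor ((E v a xor e) xor t)
          ≡⟨ xor-cancel-outer t (E v a) e ⟩
        e ∎

    module _ {e K} (c : UniformCut J K e) (w' : Fin n) where
      open UniformCut c

      private
        S = sameSideAs side w'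

        same-side : ∀ {x} → x ∈ K ∩ S → side x ≡ side w'
        same-side x∈K' = witness (proj₂ (∩-⁻ K S x∈K'))

        other-side : ∀ {x} → x ∈ K → x ∉ K ∩ S → side x ≢ side w'
        other-side x∈K x∉K' = refutation (∉-∩ K S x∈K x∉K')

        across-part : ∀ {a b} → a ∈ K ∩ S → b ∈ K → b ∉ K ∩ S → J a b ≡ e
        across-part a∈K' b∈K b∉K' =
          across (proj₁ (∩-⁻ K S a∈K')) b∈K
                 λ same → other-side b∈K b∉K' (trans (sym same) (same-side a∈K'))

      -- Across the cut J is constantly e, so a vertex on the other side sees the part like v or oppositely.
      cut-part-homogeneous : Homogeneous K → Homogeneous (K ∩ S)
      cut-part-homogeneous hom {b} b∉K' with ∈-or-∉ K b
      ... | inj₂ b∉K = let t , sees = hom b∉K in t , λ x∈K' → sees (proj₁ (∩-⁻ K S x∈K'))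
      ... | inj₁ b∈K = e xor E v b , λ {x} x∈K' → begin
        E b x                       ≡⟨ sym (switch-involutive (E v) E b x) ⟩
        J b x xor (E v b xor E v x) ≡⟨ cong (_xor (E v b xor E v x)) (flipped (across-part x∈K' b∈K b∉K')) ⟩
        e xor (E v b xor E v x)     ≡⟨ sym (xor-assoc e (E v b) (E v x)) ⟩
        (e xor E v b) xor E v x     ∎

      cut-part-closed : Homogeneous K → ∀ {w} → w ∈ K → Closed (switchingFlip E (colouring e K w) e) (K ∩ S)
      cut-part-closed hom {w} w∈K {a} {b} a∈K' a~b with ∈-or-∉ (K ∩ S) b
      ... | inj₁ b∈K' = b∈K'
      ... | inj₂ b∉K' = case trans (sym a~b) (nonedge (colouring e K w) e a≁b) of λ ()
        where
        a∈K = proj₁ (∩-⁻ K S a∈K')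
        a≁b : switch (colouring e K w) E a b ≡ e
        a≁b with ∈-or-∉ K b
        ... | inj₂ b∉K = strategy-leaves hom w∈K a∈K b∉K
        ... | inj₁ b∈K = trans (strategy-inside a∈K b∈K) (across-part a∈K' b∈K b∉K')

    wins-from : ∀ K → Acc _≺_ K → Homogeneous K → ∀ {H w} → w ∈ K → Closed H K → FlipperWins r 2 G H w
    wins-from K (acc smaller) hom {w = w} w∈K closed with cograph-decomposition J-sym K
    ... | inj₂ (inj₁ path) = ⊥-elim (G-free (induced-P4-forbidden path))
    ... | inj₁ at-most-one =
      move (toFin2 ∘ colouring false K w) (switching false) λ _ reach →
        inj₁ (isolated (reach-closed r closed reach w∈K))
      where
      isolated : ∀ {w'} → w' ∈ K → Isolated (switchingFlip E (colouring false K w) false) w'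
      isolated {w'} w'∈K b with ∈-or-∉ K b
      ... | inj₁ b∈K with at-most-one w'∈K b∈K
      ...   | refl = loop (colouring false K w) false w'
      isolated {w'} w'∈K b | inj₂ b∉K = nonedge (colouring false K w) false (strategy-leaves hom w∈K w'∈K b∉K)
    ... | inj₂ (inj₂ (e , c)) =
      move (toFin2 ∘ colouring e K w) (switching e) λ w' reach →
        let S = sameSideAs (UniformCut.side c) w' in
        inj₂ (wins-from (K ∩ S) (smaller (cut-part-≺ c w')) (cut-part-homogeneous c w' hom)
                        (∩-⁺ K S (reach-closed r closed reach w∈K) (sameSideAs-self (UniformCut.side c) w'))
                        (cut-part-closed c w' hom w∈K))

    -- First isolate v by switching along N(v); the runner, if not at v, is then confined to V ∖ {v}.
    wins : FlipperWins r 2 G E v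
    wins = move (toFin2 ∘ E v) (switching false) next
      where
      opening = switchingFlip E (E v) false

      next : ∀ w → Reach r E v w → Isolated opening w ⊎ FlipperWins r 2 G opening w
      next w _ with ≡-or-≢ w v
      ... | inj₁ refl = inj₁ λ b → nonedge (E v) false (J-row b)
      ... | inj₂ w≢v  = inj₂ (wins-from (allBut v) (≺-wellFounded _) hom (allBut-∈ w≢v) closed)
        where
        hom : Homogeneous (allBut v)
        hom b∉ with allBut-∉ b∉
        ... | refl = false , λ _ → refl
        closed : Closed opening (allBut v)
        closed {a} {b} _ a~b with ∈-or-∉ (allBut v) b
        ... | inj₁ b∈ = b∈
        ... | inj₂ b∉ with allBut-∉ b∉
        ...   | refl = case trans (sym a~b) (nonedge (E v) false (J-col a)) of λ ()

  flipper-wins : FlipperWinsGame r 2 G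
  flipper-wins = wins

-- The runner's strategy

-- A 2-flip of a graph on Fin m, coded by the colour class of each vertex and by whether the pairs
-- inside class 0, inside class 1 and across the classes are flipped.
pairIndex : Bool → Bool → Fin 3
pairIndex false false = # 0
pairIndex true  true  = # 1
pairIndex _     _     = # 2

codeFlip : Adj m → Subset m → Subset 3 → Adj m
codeFlip F γ q i j = not ⌊ i ≟ j ⌋ ∧ (F i j xor lookup q (pairIndex (lookup γ i) (lookup γ j)))

codeFlip-⊥ : ∀ {F : Adj m} → Irreflexive F → ∀ i j → codeFlip F Subset.⊥ Subset.⊥ i j ≡ F i j
codeFlip-⊥ {F = F} F-irr i j with i ≟ j
... | yes refl = sym (F-irr i)
... | no _     = trans (cong (F i j xor_) (lookup-replicate (pairIndex (lookup Subset.⊥ i) (lookup Subset.⊥ j)) false))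
                       (xor-identityʳ (F i j))

symmetric-pattern-code : k ≤ 2 → (φ : Fin k → Fin k → Bool) → (∀ a b → φ a b ≡ φ b a) →
  (δ : Fin m → Fin k) →
  ∃₂ λ γ q → ∀ i j → φ (δ i) (δ j) ≡ lookup q (pairIndex (lookup γ i) (lookup γ j))
symmetric-pattern-code z≤n φ _ δ = Subset.⊥ , Subset.⊥ , λ i → case δ i of λ ()
symmetric-pattern-code (s≤s z≤n) φ _ δ = Subset.⊥ , q , agrees
  where
  q = replicate 3 (φ zero zero)
  agrees : ∀ i j → φ (δ i) (δ j) ≡ lookup q (pairIndex (lookup Subset.⊥ i) (lookup Subset.⊥ j))
  agrees i j with δ i | δ j
  ... | zero | zero = sym (lookup-replicate (pairIndex (lookup Subset.⊥ i) (lookup Subset.⊥ j)) (φ zero zero))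
symmetric-pattern-code (s≤s (s≤s z≤n)) φ φ-sym δ = γ , q , agrees
  where
  isOne : Fin 2 → Bool
  isOne zero       = false
  isOne (suc zero) = true
  q = φ zero zero ∷ φ (suc zero) (suc zero) ∷ φ zero (suc zero) ∷ []
  on-colours : ∀ a b → φ a b ≡ lookup q (pairIndex (isOne a) (isOne b))
  on-colours zero       zero       = refl
  on-colours zero       (suc zero) = refl
  on-colours (suc zero) zero       = φ-sym (suc zero) zero
  on-colours (suc zero) (suc zero) = refl
  γ = tabulate (isOne ∘ δ)
  agrees : ∀ i j → φ (δ i) (δ j) ≡ lookup q (pairIndex (lookup γ i) (lookup γ j))
  agrees i j rewrite lookup∘tabulate (isOne ∘ δ) i | lookup∘tabulate (isOne ∘ δ) j = on-colours (δ i) (δ j)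

restricted-flip-code : ∀ {E : Adj n} {F : Adj m} {f : Fin m → Fin n} → Irreflexive E → Injective _≡_ _≡_ f →
  (∀ i j → E (f i) (f j) ≡ F i j) → k ≤ 2 → (c : Fin n → Fin k) (S : List (Fin k × Fin k)) →
  ∃₂ λ γ q → ∀ i j → partFlip E c S (f i) (f j) ≡ codeFlip F γ q i j
restricted-flip-code {E = E} {F} {f} E-irr f-inj emb k≤2 c S
  with symmetric-pattern-code k≤2 (flipPattern S) (flipPattern-sym S) (c ∘ f)
... | γ , q , agrees = γ , q , λ i j → begin
  partFlip E c S (f i) (f j)                                         ≡⟨ partFlip-pattern E-irr c S (f i) (f j) ⟩
  not ⌊ f i ≟ f j ⌋ ∧ (E (f i) (f j) xor flipPattern S (c (f i)) (c (f j)))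
    ≡⟨ cong₂ (λ d z → not d ∧ z) (same-test i j) (cong₂ _xor_ (emb i j) (agrees i j)) ⟩
  codeFlip F γ q i j                                                 ∎
  where
  same-test : ∀ i j → ⌊ f i ≟ f j ⌋ ≡ ⌊ i ≟ j ⌋
  same-test i j with i ≟ j
  ... | yes refl = ⌊⌋-yes (f i ≟ f i) refl
  ... | no i≢j   = ⌊⌋-no (f i ≟ f j) (i≢j ∘ f-inj)

HasNeighbour : Adj m → Fin m → Set
HasNeighbour H x = ∃ λ y → H x y ≡ true

hasNeighbour? : (H : Adj m) → ∀ x → Dec (HasNeighbour H x)
hasNeighbour? H x = any? λ y → H x y Bool.≟ true

Within2 : Adj m → Fin m → Fin m → Set
Within2 H x y = x ≡ y ⊎ H x y ≡ true ⊎ ∃ λ z → H x z ≡ true × H z y ≡ true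

within2? : (H : Adj m) → ∀ x y → Dec (Within2 H x y)
within2? H x y =
  (x ≟ y) ⊎-dec (H x y Bool.≟ true) ⊎-dec any? λ z → (H x z Bool.≟ true) ×-dec (H z y Bool.≟ true)

within2-walk : ∀ {H : Adj m} {x y} → Within2 H x y → Walk H 2 x y
within2-walk (inj₁ refl)                 = here
within2-walk (inj₂ (inj₁ xy))            = step xy here
within2-walk (inj₂ (inj₂ (_ , xz , zy))) = step xz (step zy here)

Escape : Adj m → Set
Escape F = ∀ γ q γ' q' x → HasNeighbour (codeFlip F γ q) x →
  ∃ λ t → Within2 (codeFlip F γ q) x t × HasNeighbour (codeFlip F γ' q') t

NeverTwoIsolated : Adj m → VSet m → Set
NeverTwoIsolated F U = ∀ γ q y z → y ∈ U → z ∈ U → y ≢ z →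
  HasNeighbour (codeFlip F γ q) y ⊎ HasNeighbour (codeFlip F γ q) z

Guarded : Adj m → VSet m → Set
Guarded F U = ∀ γ q x → HasNeighbour (codeFlip F γ q) x →
  ∃₂ λ y z → y ∈ U × z ∈ U × y ≢ z × Within2 (codeFlip F γ q) x y × Within2 (codeFlip F γ q) x z

-- Whatever the next flip, one of the two guards reachable from x keeps a neighbour.
escape-by-guards : ∀ (F : Adj m) (U : VSet m) → NeverTwoIsolated F U → Guarded F U → Escape F
escape-by-guards F U never guarded γ q γ' q' x x-free with guarded γ q x x-free
... | y , z , y∈U , z∈U , y≢z , x→y , x→z with never γ' q' y z y∈U z∈U y≢z
...   | inj₁ y-free = y , x→y , y-free
...   | inj₂ z-free = z , x→z , z-free

allSubset? : ∀ {P : Pred (Subset m) 0ℓ} → Decidable P → Dec (∀ s → P s)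
allSubset? P? = map′ (λ ¬∃¬ s → decidable-stable (P? s) (λ ¬p → ¬∃¬ (s , ¬p)))
                     (λ ∀p (s , ¬p) → ¬p (∀p s))
                     (¬? (anySubset? (¬? ∘ P?)))

neverTwoIsolated? : (F : Adj m) (U : VSet m) → Dec (NeverTwoIsolated F U)
neverTwoIsolated? F U = allSubset? λ γ → allSubset? λ q → all? λ y → all? λ z →
  (U y Bool.≟ true) →-dec (U z Bool.≟ true) →-dec ¬? (y ≟ z) →-dec
  (hasNeighbour? (codeFlip F γ q) y ⊎-dec hasNeighbour? (codeFlip F γ q) z)

guarded? : (F : Adj m) (U : VSet m) → Dec (Guarded F U)
guarded? F U = allSubset? λ γ → allSubset? λ q → all? λ x → hasNeighbour? (codeFlip F γ q) x →-dec
  any? λ y → any? λ z → (U y Bool.≟ true) ×-dec (U z Bool.≟ true) ×-dec ¬? (y ≟ z) ×-dec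
    within2? (codeFlip F γ q) x y ×-dec within2? (codeFlip F γ q) x z

escape-by-computation : ∀ (F : Adj m) (U : VSet m) →
  {_ : True (neverTwoIsolated? F U)} {_ : True (guarded? F U)} → Escape F
escape-by-computation F U {never} {guarded} = escape-by-guards F U (toWitness never) (toWitness guarded)

-- The vertices other than v4 serve as guards.
C5-escape : Escape C5
C5-escape = escape-by-computation C5 (allBut v4)

bull-escape : Escape bull
bull-escape = escape-by-computation bull (allBut v4)

gem-escape : Escape gem
gem-escape = escape-by-computation gem (allBut v4)

cogem-escape : Escape cogem
cogem-escape = escape-by-computation cogem (allBut v4)

walk-weaken : ∀ {H : Adj n} {l l' u w} → l ≤ l' → Walk H l u w → Walk H l' u w
walk-weaken _         here        = here
walk-weaken (s≤s l≤l') (step uv walk) = step uv (walk-weaken l≤l' walk)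

walk-image : ∀ {H : Adj n} {T : Adj m} {f : Fin m → Fin n} → (∀ i j → H (f i) (f j) ≡ T i j) →
  ∀ {l x y} → Walk T l x y → Walk H l (f x) (f y)
walk-image image here                     = here
walk-image image (step {v = z} xz walk) = step (trans (image _ z) xz) (walk-image image walk)

reach-within2 : ∀ {r} → ValidRadius r → ∀ {H : Adj n} {u w} → Walk H 2 u w → Reach r H u w
reach-within2 {r = fin _} 2≤r walk = walk-weaken 2≤r walk
reach-within2 {r = ∞}     _   walk = 2 , walk

module _ {n m} (G : SimpleGraph n) {r : Radius} (r-valid : ValidRadius r) {F : Adj m} (escape : Escape F)
         {f : Fin m → Fin n} (f-inj : Injective _≡_ _≡_ f) (f-emb : ∀ i j → adj G (f i) (f j) ≡ F i j) where

  record Position (H : Adj n) (w : Fin n) : Set where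
    constructor at
    field
      colours : Subset m
      flips   : Subset 3
      x       : Fin m
      w≡fx    : w ≡ f x
      restricts : ∀ i j → H (f i) (f j) ≡ codeFlip F colours flips i j
      x-free  : HasNeighbour (codeFlip F colours flips) x

  survives : ∀ {k H w} → k ≤ 2 → Position H w → ¬ FlipperWins r k G H w
  survives k≤2 (at γ q x refl restricts x-free) (move c S next)
    with restricted-flip-code {E = adj G} (irrefl G) f-inj f-emb k≤2 c S
  ... | γ' , q' , restricts' with escape γ q γ' q' x x-free
  ...   | t , x→t , (y , t~y) with next (f t) (reach-within2 r-valid (walk-image restricts (within2-walk x→t)))
  ...     | inj₁ isolated = case trans (sym t~y) (trans (sym (restricts' t y)) (isolated (f y))) of λ ()
  ...     | inj₂ wins     = survives k≤2 (at γ' q' t refl restricts' (y , t~y)) wins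

  escape-excludes : ∀ x₀ → HasNeighbour F x₀ → ¬ FlipWidthAtMost r 2 G
  escape-excludes x₀ (y₀ , x₀~y₀) (k , k≤2 , wins) = survives k≤2 start (wins (f x₀))
    where
    F-irr : Irreflexive F
    F-irr i = trans (sym (f-emb i i)) (irrefl G (f i))
    start : Position (adj G) (f x₀)
    start = at Subset.⊥ Subset.⊥ x₀ refl (λ i j → trans (f-emb i j) (sym (codeFlip-⊥ F-irr i j)))
               (y₀ , trans (codeFlip-⊥ F-irr x₀ y₀) x₀~y₀)

forbidden-excludes : ∀ {n} (G : SimpleGraph n) {r} → ValidRadius r → Forbidden (adj G) → ¬ FlipWidthAtMost r 2 G
forbidden-excludes G valid (inj₁ (_ , inj , emb)) =
  escape-excludes G valid C5-escape inj emb v0 (v1 , refl)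
forbidden-excludes G valid (inj₂ (inj₁ (_ , inj , emb))) =
  escape-excludes G valid bull-escape inj emb v0 (v1 , refl)
forbidden-excludes G valid (inj₂ (inj₂ (inj₁ (_ , inj , emb)))) =
  escape-excludes G valid gem-escape inj emb v0 (v1 , refl)
forbidden-excludes G valid (inj₂ (inj₂ (inj₂ (_ , inj , emb)))) =
  escape-excludes G valid cogem-escape inj emb v0 (v1 , refl)

theorem1p1 : (r : Radius) → ValidRadius r → (n : ℕ) → (G : SimpleGraph n) →
    FlipWidthAtMost r 2 G ⇔
      (¬ (HasInduced G C5 ⊎ HasInduced G bull ⊎ HasInduced G gem ⊎ HasInduced G cogem))
theorem1p1 r valid n G =
  mk⇔ (λ fw forbidden → forbidden-excludes G valid forbidden fw)
      (λ free → 2 , ≤-refl , flipper-wins G free r)
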